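{- Let $G$ be a finite simple graph with $\theta(G)=D(G)$. Then either $\theta(G)=1$ or $\theta(G)=|V(G)|$.
   Context: A vertex coloring is distinguishing if no non-identity automorphism of $G$ preserves it. $D(G)$, the distinguishing number, is the minimum number of colors in a distinguishing coloring of $G$. $\theta(G)$, the distinguishing threshold, is the minimum $k$ such that every vertex coloring of $G$ using $k$ colors is distinguishing; equivalently $\theta(G)=1+\max\{c(\alpha):\alpha\in\mathrm{Aut}(G)\}$ where $c(\alpha)$ is the number of cycles (fixed points included) of $\alpha$ and $c(\mathrm{id})=0$. -}

module Defs where

open import Data.Nat using (ℕ; _≤_; _<_)
open import Data.Bool using (Bool; false)
open import Data.Fin using (Fin)
open import Data.Fin.Permutation using (Permutation′; _⟨$⟩ʳ_)
open import Data.Product using (Σ; _×_)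
open import Function.Definitions using (Surjective)
open import Relation.Binary.PropositionalEquality using (_≡_)
open import Relation.Nullary using (¬_)

record Graph (n : ℕ) : Set where
  field
    adj   : Fin n → Fin n → Bool
    sym   : ∀ u v → adj u v ≡ adj v u
    irrfl : ∀ v → adj v v ≡ false
open Graph public

IsAutomorphism : ∀ {n} → Graph n → Permutation′ n → Set
IsAutomorphism G π = ∀ u v → adj G (π ⟨$⟩ʳ u) (π ⟨$⟩ʳ v) ≡ adj G u v

IsIdentity : ∀ {n} → Permutation′ n → Set
IsIdentity π = ∀ v → π ⟨$⟩ʳ v ≡ v

Colouring : ℕ → ℕ → Set
Colouring n k = Fin n → Fin k

Preserves : ∀ {n k} → Permutation′ n → Colouring n k → Set
Preserves π c = ∀ v → c (π ⟨$⟩ʳ v) ≡ c v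

Distinguishing : ∀ {n k} → Graph n → Colouring n k → Set
Distinguishing G c =
  ∀ π → IsAutomorphism G π → Preserves π c → IsIdentity π

UsesExactly : ∀ {n k} → Colouring n k → Set
UsesExactly {n} {k} c = Surjective {A = Fin n} {B = Fin k} _≡_ _≡_ c

-- D(G) = d : d is the least number of colours admitting a distinguishing colouring.
IsDistinguishingNumber : ∀ {n} → Graph n → ℕ → Set
IsDistinguishingNumber {n} G d =
  Σ (Colouring n d) (Distinguishing G)
  × (∀ k → Σ (Colouring n k) (Distinguishing G) → d ≤ k)

AllDistinguishing : ∀ {n} → Graph n → ℕ → Set
AllDistinguishing {n} G k =
  (c : Colouring n k) → UsesExactly c → Distinguishing G c

-- θ(G) = t : t is the least positive k such that every colouring using
-- exactly k colours is distinguishing.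
IsDistinguishingThreshold : ∀ {n} → Graph n → ℕ → Set
IsDistinguishingThreshold G t =
  (1 ≤ t) × AllDistinguishing G t
  × (∀ k → 1 ≤ k → AllDistinguishing G k → t ≤ k)

{-# OPTIONS --safe #-}

-- Suppose 2 ≤ t < n for t = θ(G) = D(G). Then every colouring using exactly t colours is
-- distinguishing, and we build a distinguishing colouring with t − 1 colours, contradicting D(G) = t.
--
-- t = 2: an automorphism preserving a nonempty proper vertex set preserves a 2-colouring, so it is
-- trivial. Hence a non-trivial automorphism β fixes no vertex, swaps no pair, and has a single
-- orbit v, β v, β² v, …; but then the reflection βⁱ v ↦ β⁻ⁱ v is an automorphism fixing v, hence
-- trivial, which forces β² v = v. So G is rigid and one colour distinguishes it.
--
-- t ≥ 3: fix two vertices a and b, and suppose a vertex x is adjacent to exactly one of them.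
-- Colour x alone and the others, a and b alike, with t − 2 further colours. An automorphism
-- preserving this fixes x, hence preserves adjacency to x, hence preserves the t-colouring splitting
-- the colour of a and b by adjacency to x: it is trivial. If there is no such x, a and b are twins,
-- and their transposition preserves a t-colouring (t < n) that gives a and b the same colour.

module Submission where

open import Defs renaming (sym to adj-sym)
open import Data.Bool.Base using (Bool; true; false; if_then_else_)
open import Data.Bool.Properties using (¬-not) renaming (_≟_ to _≟ᵇ_)
open import Data.Fin.Base using (Fin; zero; suc; toℕ; fromℕ<; punchIn; punchOut)
open import Data.Fin.Patterns using (0F; 1F)
open import Data.Fin.Permutation
  using (Permutation′; _⟨$⟩ʳ_; _⟨$⟩ˡ_; id; _∘ₚ_; permutation; inverseʳ; transpose)
open import Data.Fin.Properties
  using (_≟_; toℕ-fromℕ<; toℕ-injective; toℕ<n; fromℕ<-cong; pigeonhole; any?; all?; ¬∀⟶∃¬;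
         punchInᵢ≢i; punchIn-injective; punchIn-punchOut; punchOut-punchIn; punchOut-cong)
open import Data.Nat.Base
  using (ℕ; zero; suc; pred; _+_; _*_; _⊓_; _≤_; _<_; z≤n; s≤s; s≤s⁻¹; NonZero; >-nonZero)
open import Data.Nat.DivMod using (_%_; _/_; m%n<n; m≡m%n+[m/n]*n)
open import Data.Nat.Properties
  using (≤-refl; ≤-trans; +-comm; +-suc; n<1+n; m<n⇒m<1+n; ≤∧≢⇒<; m⊓n≤n; m≤n⇒m⊓n≡m;
         m≤n⇒∃[o]m+o≡n; <⇒≤; n≮n; m≤pred[n]⇒suc[m]≤n)
  renaming (_≟_ to _≟ℕ_)
open import Data.Product using (∃; Σ; _×_; _,_; proj₁; proj₂)
open import Data.Sum using (_⊎_; inj₁; inj₂; [_,_])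
open import Function.Base using (_∘_)
open import Function.Bundles using (Injection; _⇔_; mk⇔)
open import Function.Properties.Inverse using (↔⇒↣)
open import Level using (0ℓ)
open import Relation.Binary.PropositionalEquality
  using (_≡_; _≢_; refl; sym; trans; cong; cong₂; module ≡-Reasoning)
open import Relation.Nullary using (¬_; Dec; yes; no; does; contradiction)
open import Relation.Nullary.Decidable using (map′; does-⇔; dec-true; dec-false; _⊎-dec_)
open import Relation.Unary using (Pred; Decidable)

⟨$⟩ʳ-injective : ∀ {n} (π : Permutation′ n) {u v} → π ⟨$⟩ʳ u ≡ π ⟨$⟩ʳ v → u ≡ v
⟨$⟩ʳ-injective π = Injection.injective (↔⇒↣ π)

infix 10 _^ₚ_

_^ₚ_ : ∀ {n} → Permutation′ n → ℕ → Permutation′ n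
π ^ₚ zero  = id
π ^ₚ suc i = (π ^ₚ i) ∘ₚ π

Onto : ∀ {n} → ℕ → (Fin n → ℕ) → Set
Onto k f = ∀ j → j < k → ∃ λ v → f v ≡ j

Orbit : ∀ {n} → Permutation′ n → Fin n → Pred (Fin n) 0ℓ
Orbit π v u = ∃ λ i → π ^ₚ i ⟨$⟩ʳ v ≡ u

module _ {n} (π : Permutation′ n) where

  ^ₚ-cong : ∀ {i j} v → i ≡ j → π ^ₚ i ⟨$⟩ʳ v ≡ π ^ₚ j ⟨$⟩ʳ v
  ^ₚ-cong v refl = refl

  ^ₚ-+ : ∀ i j v → π ^ₚ (i + j) ⟨$⟩ʳ v ≡ π ^ₚ i ⟨$⟩ʳ (π ^ₚ j ⟨$⟩ʳ v)
  ^ₚ-+ zero    j v = refl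
  ^ₚ-+ (suc i) j v = cong (π ⟨$⟩ʳ_) (^ₚ-+ i j v)

  ^ₚ-comm : ∀ i j v → π ^ₚ i ⟨$⟩ʳ (π ^ₚ j ⟨$⟩ʳ v) ≡ π ^ₚ j ⟨$⟩ʳ (π ^ₚ i ⟨$⟩ʳ v)
  ^ₚ-comm i j v = begin
    π ^ₚ i ⟨$⟩ʳ (π ^ₚ j ⟨$⟩ʳ v)  ≡⟨ ^ₚ-+ i j v ⟨
    π ^ₚ (i + j) ⟨$⟩ʳ v          ≡⟨ ^ₚ-cong v (+-comm i j) ⟩
    π ^ₚ (j + i) ⟨$⟩ʳ v          ≡⟨ ^ₚ-+ j i v ⟩
    π ^ₚ j ⟨$⟩ʳ (π ^ₚ i ⟨$⟩ʳ v)  ∎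
    where open ≡-Reasoning

  ^ₚ-*-fixes : ∀ {p v} → π ^ₚ p ⟨$⟩ʳ v ≡ v → ∀ q → π ^ₚ (q * p) ⟨$⟩ʳ v ≡ v
  ^ₚ-*-fixes         πᵖv≡v zero    = refl
  ^ₚ-*-fixes {p} {v} πᵖv≡v (suc q) =
    trans (^ₚ-+ p (q * p) v) (trans (cong (π ^ₚ p ⟨$⟩ʳ_) (^ₚ-*-fixes πᵖv≡v q)) πᵖv≡v)

  ^ₚ-returns : ∀ v → ∃ λ p → π ^ₚ suc p ⟨$⟩ʳ v ≡ v
  ^ₚ-returns v =
    let i , j , i<j , πⁱv≡πʲv = pigeonhole (n<1+n n) (λ i → π ^ₚ toℕ i ⟨$⟩ʳ v)
        o , i+1+o≡j = m≤n⇒∃[o]m+o≡n i<j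
    in o , ⟨$⟩ʳ-injective (π ^ₚ toℕ i) (sym (begin
      π ^ₚ toℕ i ⟨$⟩ʳ v                       ≡⟨ πⁱv≡πʲv ⟩
      π ^ₚ toℕ j ⟨$⟩ʳ v                       ≡⟨ ^ₚ-cong v (trans (sym i+1+o≡j) (sym (+-suc (toℕ i) o))) ⟩
      π ^ₚ (toℕ i + suc o) ⟨$⟩ʳ v             ≡⟨ ^ₚ-+ (toℕ i) (suc o) v ⟩
      π ^ₚ toℕ i ⟨$⟩ʳ (π ^ₚ suc o ⟨$⟩ʳ v)     ∎))
    where open ≡-Reasoning

  ^ₚ-% : ∀ {p v} .{{_ : NonZero p}} → π ^ₚ p ⟨$⟩ʳ v ≡ v →
         ∀ i → π ^ₚ (i % p) ⟨$⟩ʳ v ≡ π ^ₚ i ⟨$⟩ʳ v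
  ^ₚ-% {p} {v} πᵖv≡v i = begin
    π ^ₚ (i % p) ⟨$⟩ʳ v                          ≡⟨ cong (π ^ₚ (i % p) ⟨$⟩ʳ_) (^ₚ-*-fixes πᵖv≡v (i / p)) ⟨
    π ^ₚ (i % p) ⟨$⟩ʳ (π ^ₚ (i / p * p) ⟨$⟩ʳ v)  ≡⟨ ^ₚ-+ (i % p) (i / p * p) v ⟨
    π ^ₚ (i % p + i / p * p) ⟨$⟩ʳ v              ≡⟨ ^ₚ-cong v (m≡m%n+[m/n]*n i p) ⟨
    π ^ₚ i ⟨$⟩ʳ v                                ∎
    where open ≡-Reasoning

  orbit-invariant : ∀ {v u} → Orbit π v (π ⟨$⟩ʳ u) ⇔ Orbit π v u
  orbit-invariant {v} {u} = mk⇔ back (λ (i , πⁱv≡u) → suc i , cong (π ⟨$⟩ʳ_) πⁱv≡u)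
    where
    back : Orbit π v (π ⟨$⟩ʳ u) → Orbit π v u
    back (zero  , v≡πu)     = let p , πᵖ⁺¹v≡v = ^ₚ-returns v in p , ⟨$⟩ʳ-injective π (trans πᵖ⁺¹v≡v v≡πu)
    back (suc i , πⁱ⁺¹v≡πu) = i , ⟨$⟩ʳ-injective π πⁱ⁺¹v≡πu

  orbit? : ∀ v → Decidable (Orbit π v)
  orbit? v u = map′ (λ (i , πⁱv≡u) → toℕ i , πⁱv≡u) reduce (any? λ i → π ^ₚ toℕ i ⟨$⟩ʳ v ≟ u)
    where
    p = suc (proj₁ (^ₚ-returns v))
    reduce : Orbit π v u → ∃ λ (i : Fin p) → π ^ₚ toℕ i ⟨$⟩ʳ v ≡ u
    reduce (i , πⁱv≡u) =
      fromℕ< (m%n<n i p) ,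
      trans (^ₚ-cong v (toℕ-fromℕ< (m%n<n i p))) (trans (^ₚ-% (proj₂ (^ₚ-returns v)) i) πⁱv≡u)

module _ {n} (G : Graph n) where

  isAutomorphism-∘ₚ : ∀ {π σ} → IsAutomorphism G π → IsAutomorphism G σ →
                      IsAutomorphism G (π ∘ₚ σ)
  isAutomorphism-∘ₚ π-aut σ-aut u v = trans (σ-aut _ _) (π-aut u v)

  isAutomorphism-^ₚ : ∀ {π} → IsAutomorphism G π → ∀ i → IsAutomorphism G (π ^ₚ i)
  isAutomorphism-^ₚ       aut zero    u v = refl
  isAutomorphism-^ₚ {π} aut (suc i) = isAutomorphism-∘ₚ {π ^ₚ i} {π} (isAutomorphism-^ₚ aut i) aut

toColouring : ∀ {n k} (f : Fin n → ℕ) → (∀ v → f v < k) → Colouring n k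
toColouring f f<k v = fromℕ< (f<k v)

module _ {n k} {f : Fin n → ℕ} (f<k : ∀ v → f v < k) where

  toColouring-usesExactly : Onto k f → UsesExactly (toColouring f f<k)
  toColouring-usesExactly onto c =
    let v , fv≡c = onto (toℕ c) (toℕ<n c)
    in v , λ { refl → toℕ-injective (trans (toℕ-fromℕ< (f<k v)) fv≡c) }

  toColouring-preserves : ∀ {π} → (∀ v → f (π ⟨$⟩ʳ v) ≡ f v) → Preserves π (toColouring f f<k)
  toColouring-preserves f∘π≗f v = fromℕ<-cong _ _ (f∘π≗f v) _ _

  preserves-toColouring : ∀ {π} → Preserves π (toColouring f f<k) → ∀ v → f (π ⟨$⟩ʳ v) ≡ f v
  preserves-toColouring pres v =
    trans (sym (toℕ-fromℕ< (f<k _))) (trans (cong toℕ (pres v)) (toℕ-fromℕ< (f<k v)))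

allDistinguishing⇒identity : ∀ {n k} (G : Graph n) → AllDistinguishing G k →
  (f : Fin n → ℕ) (f<k : ∀ v → f v < k) → Onto k f →
  ∀ π → IsAutomorphism G π → (∀ v → f (π ⟨$⟩ʳ v) ≡ f v) → IsIdentity π
allDistinguishing⇒identity G allDist f f<k onto π aut f∘π≗f =
  allDist (toColouring f f<k) (toColouring-usesExactly f<k onto) π aut
    (toColouring-preserves f<k {π} f∘π≗f)

-- ρ (βⁱ v) = β⁻ⁱ v: G is circulant on the cycle v, β v, β² v, …, so this reflection is an automorphism.
module Reflection {n} (G : Graph n) {β} (aut : IsAutomorphism G β)
                  {v} (transitive : ∀ u → Orbit β v u) where

  index : Fin n → ℕ
  index u = proj₁ (transitive u)

  ρ : Fin n → Fin n
  ρ u = β ^ₚ index u ⟨$⟩ˡ v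

  open ≡-Reasoning

  ρ-spec : ∀ {i u} → β ^ₚ i ⟨$⟩ʳ v ≡ u → β ^ₚ i ⟨$⟩ʳ ρ u ≡ v
  ρ-spec {i} {u} βⁱv≡u = ⟨$⟩ʳ-injective (β ^ₚ index u) (begin
    β ^ₚ index u ⟨$⟩ʳ (β ^ₚ i ⟨$⟩ʳ ρ u)  ≡⟨ ^ₚ-comm β (index u) i (ρ u) ⟩
    β ^ₚ i ⟨$⟩ʳ (β ^ₚ index u ⟨$⟩ʳ ρ u)  ≡⟨ cong (β ^ₚ i ⟨$⟩ʳ_) (inverseʳ (β ^ₚ index u)) ⟩
    β ^ₚ i ⟨$⟩ʳ v                         ≡⟨ trans βⁱv≡u (sym (proj₂ (transitive u))) ⟩
    β ^ₚ index u ⟨$⟩ʳ v                   ∎)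

  ρ-shift : ∀ a b → β ^ₚ (index b + index a) ⟨$⟩ʳ ρ a ≡ b
  ρ-shift a b = begin
    β ^ₚ (index b + index a) ⟨$⟩ʳ ρ a         ≡⟨ ^ₚ-+ β (index b) (index a) (ρ a) ⟩
    β ^ₚ index b ⟨$⟩ʳ (β ^ₚ index a ⟨$⟩ʳ ρ a)
      ≡⟨ cong (β ^ₚ index b ⟨$⟩ʳ_) (ρ-spec {index a} (proj₂ (transitive a))) ⟩
    β ^ₚ index b ⟨$⟩ʳ v                       ≡⟨ proj₂ (transitive b) ⟩
    b                                         ∎

  ρ-involutive : ∀ u → ρ (ρ u) ≡ u
  ρ-involutive u = ⟨$⟩ʳ-injective (β ^ₚ j) (begin
    β ^ₚ j ⟨$⟩ʳ ρ (ρ u)                 ≡⟨ ρ-spec {j} (proj₂ (transitive (ρ u))) ⟩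
    v                                   ≡⟨ ρ-spec {index u} (proj₂ (transitive u)) ⟨
    β ^ₚ index u ⟨$⟩ʳ ρ u               ≡⟨ cong (β ^ₚ index u ⟨$⟩ʳ_) (proj₂ (transitive (ρ u))) ⟨
    β ^ₚ index u ⟨$⟩ʳ (β ^ₚ j ⟨$⟩ʳ v)   ≡⟨ ^ₚ-comm β (index u) j v ⟩
    β ^ₚ j ⟨$⟩ʳ (β ^ₚ index u ⟨$⟩ʳ v)   ≡⟨ cong (β ^ₚ j ⟨$⟩ʳ_) (proj₂ (transitive u)) ⟩
    β ^ₚ j ⟨$⟩ʳ u                       ∎)
    where j = index (ρ u)

  reflection : Permutation′ n
  reflection = permutation ρ ρ ρ-involutive ρ-involutive

  reflection-fixes : reflection ⟨$⟩ʳ v ≡ v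
  reflection-fixes = ρ-spec {zero} refl

  reflection-isAutomorphism : IsAutomorphism G reflection
  reflection-isAutomorphism a b = begin
    adj G (ρ a) (ρ b)                          ≡⟨ isAutomorphism-^ₚ G aut s (ρ a) (ρ b) ⟨
    adj G (β ^ₚ s ⟨$⟩ʳ ρ a) (β ^ₚ s ⟨$⟩ʳ ρ b)  ≡⟨ cong₂ (adj G) (ρ-shift a b) ρ-shift′ ⟩
    adj G b a                                  ≡⟨ adj-sym G b a ⟩
    adj G a b                                  ∎
    where
    s = index b + index a
    ρ-shift′ : β ^ₚ s ⟨$⟩ʳ ρ b ≡ a
    ρ-shift′ = trans (^ₚ-cong β (ρ b) (+-comm (index b) (index a))) (ρ-shift b a)

avoid₂ : ∀ {n} → 3 ≤ n → (u w : Fin n) → ∃ λ z → z ≢ u × z ≢ w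
avoid₂ (s≤s (s≤s (s≤s _))) u w with u ≟ w
... | yes refl = punchIn u 0F , punchInᵢ≢i u 0F , punchInᵢ≢i u 0F
... | no u≢w   = punchIn u (punchIn w′ 0F) , punchInᵢ≢i u _ , z≢w
  where
  w′ = punchOut u≢w
  z≢w : punchIn u (punchIn w′ 0F) ≢ w
  z≢w e = punchInᵢ≢i w′ 0F (punchIn-injective u _ _ (trans e (sym (punchIn-punchOut u≢w))))

module EveryTwoColouringDistinguishing {n} (G : Graph n) (all₂ : AllDistinguishing G 2)
                                       (3≤n : 3 ≤ n) where

  invariant⇒identity : ∀ {P : Pred (Fin n) 0ℓ} → Decidable P → ∀ {u w} → P u → ¬ P w →
    ∀ π → IsAutomorphism G π → (∀ v → P (π ⟨$⟩ʳ v) ⇔ P v) → IsIdentity π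
  invariant⇒identity P? {u} {w} Pu ¬Pw π aut invariant =
    allDistinguishing⇒identity G all₂ indicator indicator<2 onto π aut
      (λ v → cong ι (does-⇔ (invariant v) (P? (π ⟨$⟩ʳ v)) (P? v)))
    where
    ι : Bool → ℕ
    ι b = if b then 0 else 1
    indicator : Fin n → ℕ
    indicator v = ι (does (P? v))
    indicator<2 : ∀ v → indicator v < 2
    indicator<2 v with does (P? v)
    ... | true  = s≤s z≤n
    ... | false = ≤-refl
    onto : Onto 2 indicator
    onto zero          _ = u , cong ι (dec-true (P? u) Pu)
    onto (suc zero)    _ = w , cong ι (dec-false (P? w) ¬Pw)
    onto (suc (suc _)) (s≤s (s≤s ()))

  fixes⇒identity : ∀ π {u} → IsAutomorphism G π → π ⟨$⟩ʳ u ≡ u → IsIdentity π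
  fixes⇒identity π {u} aut πu≡u =
    invariant⇒identity (_≟ u) refl (proj₁ (proj₂ (avoid₂ 3≤n u u))) π aut λ v →
      mk⇔ (λ πv≡u → ⟨$⟩ʳ-injective π (trans πv≡u (sym πu≡u))) λ { refl → πu≡u }

  swaps⇒identity : ∀ π {u} → IsAutomorphism G π → π ⟨$⟩ʳ (π ⟨$⟩ʳ u) ≡ u → IsIdentity π
  swaps⇒identity π {u} aut ππu≡u =
    invariant⇒identity (λ v → (v ≟ u) ⊎-dec (v ≟ π ⟨$⟩ʳ u)) (inj₁ refl) [ z≢u , z≢πu ] π aut
      λ v → mk⇔ [ (λ πv≡u → inj₂ (⟨$⟩ʳ-injective π (trans πv≡u (sym ππu≡u))))
                , (λ πv≡πu → inj₁ (⟨$⟩ʳ-injective π πv≡πu)) ]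
                [ (λ { refl → inj₂ refl }) , (λ { refl → inj₁ ππu≡u }) ]
    where
    z≢u  = proj₁ (proj₂ (avoid₂ 3≤n u (π ⟨$⟩ʳ u)))
    z≢πu = proj₂ (proj₂ (avoid₂ 3≤n u (π ⟨$⟩ʳ u)))

  rigid : ∀ β → IsAutomorphism G β → IsIdentity β
  rigid β aut u with all? (orbit? β u)
  ... | no ¬transitive =
    let w , w∉orbit = ¬∀⟶∃¬ _ (Orbit β u) (orbit? β u) ¬transitive
    in invariant⇒identity (orbit? β u) (zero , refl) w∉orbit β aut (λ _ → orbit-invariant β) u
  ... | yes transitive = swaps⇒identity β aut (begin
    β ⟨$⟩ʳ (β ⟨$⟩ʳ u)          ≡⟨ cong (β ⟨$⟩ʳ_) (proj₂ (transitive (β ⟨$⟩ʳ u))) ⟨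
    β ⟨$⟩ʳ (β ^ₚ i ⟨$⟩ʳ u)     ≡⟨ ^ₚ-comm β 1 i u ⟩
    β ^ₚ i ⟨$⟩ʳ (β ⟨$⟩ʳ u)     ≡⟨ cong (β ^ₚ i ⟨$⟩ʳ_) (reflection-identity (β ⟨$⟩ʳ u)) ⟨
    β ^ₚ i ⟨$⟩ʳ ρ (β ⟨$⟩ʳ u)   ≡⟨ ρ-spec {i} (proj₂ (transitive (β ⟨$⟩ʳ u))) ⟩
    u                          ∎) u
    where
    open Reflection G aut transitive
    open ≡-Reasoning
    i = index (β ⟨$⟩ʳ u)
    reflection-identity : IsIdentity reflection
    reflection-identity = fixes⇒identity reflection reflection-isAutomorphism reflection-fixes

clampedIndex : ∀ {n} → ℕ → Fin n → ℕ
clampedIndex k v = pred (toℕ v) ⊓ k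

clampedIndex< : ∀ {n} k (v : Fin n) → clampedIndex k v < suc k
clampedIndex< k v = s≤s (m⊓n≤n _ k)

clampedIndex-onto : ∀ {n k} → suc k < n → Onto {n} (suc k) (clampedIndex k)
clampedIndex-onto {k = k} 1+k<n j j<1+k =
  fromℕ< 1+j<n , trans (cong (λ i → pred i ⊓ k) (toℕ-fromℕ< 1+j<n)) (m≤n⇒m⊓n≡m (s≤s⁻¹ j<1+k))
  where 1+j<n = ≤-trans (s≤s j<1+k) 1+k<n

module _ {m} (G : Graph (3 + m)) where

  Twins₀₁ : Set
  Twins₀₁ = ∀ (y : Fin (suc m)) → adj G (suc (suc y)) 0F ≡ adj G (suc (suc y)) 1F

  sameAdjacency? : ∀ y → Dec (adj G (suc (suc y)) 0F ≡ adj G (suc (suc y)) 1F)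
  sameAdjacency? y = adj G (suc (suc y)) 0F ≟ᵇ adj G (suc (suc y)) 1F

  twins₀₁-or-separated :
    Twins₀₁ ⊎ ∃ λ (y : Fin (suc m)) → adj G (suc (suc y)) 0F ≢ adj G (suc (suc y)) 1F
  twins₀₁-or-separated with all? sameAdjacency?
  ... | yes twins = inj₁ twins
  ... | no ¬twins = inj₂ (¬∀⟶∃¬ _ _ sameAdjacency? ¬twins)

  transpose₀₁-isAutomorphism : Twins₀₁ → IsAutomorphism G (transpose 0F 1F)
  transpose₀₁-isAutomorphism twins 0F            0F            = trans (irrfl G 1F) (sym (irrfl G 0F))
  transpose₀₁-isAutomorphism twins 0F            1F            = adj-sym G 1F 0F
  transpose₀₁-isAutomorphism twins 0F            (suc (suc y)) =
    trans (adj-sym G 1F _) (trans (sym (twins y)) (adj-sym G _ 0F))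
  transpose₀₁-isAutomorphism twins 1F            0F            = adj-sym G 0F 1F
  transpose₀₁-isAutomorphism twins 1F            1F            = trans (irrfl G 0F) (sym (irrfl G 1F))
  transpose₀₁-isAutomorphism twins 1F            (suc (suc y)) =
    trans (adj-sym G 0F _) (trans (twins y) (adj-sym G _ 1F))
  transpose₀₁-isAutomorphism twins (suc (suc y)) 0F            = sym (twins y)
  transpose₀₁-isAutomorphism twins (suc (suc y)) 1F            = twins y
  transpose₀₁-isAutomorphism twins (suc (suc y)) (suc (suc z)) = refl

  transpose₀₁-preserves-clampedIndex : ∀ k v →
    clampedIndex k (transpose {3 + m} 0F 1F ⟨$⟩ʳ v) ≡ clampedIndex k v
  transpose₀₁-preserves-clampedIndex k 0F            = refl
  transpose₀₁-preserves-clampedIndex k 1F            = refl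
  transpose₀₁-preserves-clampedIndex k (suc (suc _)) = refl

  twins⇒¬allDistinguishing : ∀ {k} → k ≤ suc m → AllDistinguishing G (suc k) → ¬ Twins₀₁
  twins⇒¬allDistinguishing {k} k≤1+m allDist twins = contradiction (transpose-identity 0F) λ ()
    where
    transpose-identity : IsIdentity (transpose 0F 1F)
    transpose-identity =
      allDistinguishing⇒identity G allDist (clampedIndex k) (clampedIndex< k)
        (clampedIndex-onto (s≤s (s≤s k≤1+m))) (transpose 0F 1F)
        (transpose₀₁-isAutomorphism twins) (transpose₀₁-preserves-clampedIndex k)

-- Here t = 3 + k₂, and the vertex x = 2 + y separates the pair 0F, 1F.
module SeparatingVertex {m k₂} (G : Graph (3 + m)) (allDist : AllDistinguishing G (3 + k₂))
  (k₂≤m : k₂ ≤ m) (y : Fin (suc m)) (separates : adj G (suc (suc y)) 0F ≢ adj G (suc (suc y)) 1F)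
  where

  x : Fin (3 + m)
  x = suc (suc y)

  colour : Fin (3 + m) → ℕ
  colour v with x ≟ v
  ... | yes _   = 0
  ... | no x≢v = suc (clampedIndex k₂ (punchOut x≢v))

  colour< : ∀ v → colour v < 2 + k₂
  colour< v with x ≟ v
  ... | yes _   = s≤s z≤n
  ... | no x≢v = s≤s (clampedIndex< k₂ (punchOut x≢v))

  colour-x : colour x ≡ 0
  colour-x with x ≟ x
  ... | yes _   = refl
  ... | no x≢x = contradiction refl x≢x

  colour≡0⇒x : ∀ {v} → colour v ≡ 0 → x ≡ v
  colour≡0⇒x {v} with x ≟ v
  ... | yes x≡v = λ _ → x≡v
  ... | no _    = λ ()

  colour-punchIn : ∀ w → colour (punchIn x w) ≡ suc (clampedIndex k₂ w)
  colour-punchIn w with x ≟ punchIn x w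
  ... | yes x≡x↑w = contradiction (sym x≡x↑w) (punchInᵢ≢i x w)
  ... | no x≢x↑w  =
    cong (suc ∘ clampedIndex k₂) (trans (punchOut-cong x {i≢j = x≢x↑w} refl) (punchOut-punchIn x {w}))

  colour-onto : Onto (2 + k₂) colour
  colour-onto zero    _      = x , colour-x
  colour-onto (suc j) 1+j<k =
    let w , w↦j = clampedIndex-onto (s≤s (s≤s k₂≤m)) j (s≤s⁻¹ 1+j<k)
    in punchIn x w , trans (colour-punchIn w) (cong suc w↦j)

  coloured1-adjacency : ∀ b → ∃ λ v → colour v ≡ 1 × adj G x v ≡ b
  coloured1-adjacency b with b ≟ᵇ adj G x 0F
  ... | yes b≡x0 = 0F , refl , sym b≡x0
  ... | no b≢x0  = 1F , refl , trans (¬-not (separates ∘ sym)) (sym (¬-not b≢x0))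

  split : ℕ → Bool → ℕ
  split (suc zero) false = 2 + k₂
  split c          _     = c

  split< : ∀ {c} b → c < 2 + k₂ → split c b < 3 + k₂
  split< {zero}        b     _   = s≤s z≤n
  split< {suc zero}    false _   = ≤-refl
  split< {suc zero}    true  _   = s≤s (s≤s z≤n)
  split< {suc (suc c)} b     c<k = m<n⇒m<1+n c<k

  refined : Fin (3 + m) → ℕ
  refined v = split (colour v) (adj G x v)

  refined-onto : Onto (3 + k₂) refined
  refined-onto zero _ = x , cong (λ c → split c (adj G x x)) colour-x
  refined-onto (suc zero) _ =
    let v , v↦1 , xv = coloured1-adjacency true in v , cong₂ split v↦1 xv
  refined-onto (suc (suc j)) 2+j<t with j ≟ℕ k₂
  ... | yes refl =
    let v , v↦1 , x≁v = coloured1-adjacency false in v , cong₂ split v↦1 x≁v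
  ... | no j≢k₂ =
    let v , v↦2+j = colour-onto (2 + j) (s≤s (s≤s (≤∧≢⇒< (s≤s⁻¹ (s≤s⁻¹ (s≤s⁻¹ 2+j<t))) j≢k₂)))
    in v , cong (λ c → split c (adj G x v)) v↦2+j

  colouring : Colouring (3 + m) (2 + k₂)
  colouring = toColouring colour colour<

  colouring-distinguishing : Distinguishing G colouring
  colouring-distinguishing β aut pres =
    allDistinguishing⇒identity G allDist refined (λ v → split< (adj G x v) (colour< v)) refined-onto
      β aut λ v → cong₂ split (colour∘β≗colour v) (x-adjacency v)
    where
    colour∘β≗colour : ∀ v → colour (β ⟨$⟩ʳ v) ≡ colour v
    colour∘β≗colour = preserves-toColouring colour< {β} pres
    βx≡x : β ⟨$⟩ʳ x ≡ x
    βx≡x = sym (colour≡0⇒x (trans (colour∘β≗colour x) colour-x))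
    x-adjacency : ∀ v → adj G x (β ⟨$⟩ʳ v) ≡ adj G x v
    x-adjacency v = trans (cong (λ z → adj G z (β ⟨$⟩ʳ v)) (sym βx≡x)) (aut x v)

allDistinguishing⇒distinguishing-pred : ∀ {n t} (G : Graph n) → 2 ≤ t → t < n →
  AllDistinguishing G t → Σ (Colouring n (pred t)) (Distinguishing G)
allDistinguishing⇒distinguishing-pred {suc (suc (suc m))} {suc (suc zero)} G _ _ all₂ =
  (λ _ → 0F) , λ β aut _ → EveryTwoColouringDistinguishing.rigid G all₂ (s≤s (s≤s (s≤s z≤n))) β aut
allDistinguishing⇒distinguishing-pred {suc (suc (suc m))} {suc (suc (suc k₂))} G _ t<n allDist
  with twins₀₁-or-separated G
... | inj₁ twins = contradiction twins (twins⇒¬allDistinguishing G (s≤s⁻¹ (s≤s⁻¹ t<n)) allDist)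
... | inj₂ (y , separates) = colouring , colouring-distinguishing
  where open SeparatingVertex G allDist (<⇒≤ (s≤s⁻¹ (s≤s⁻¹ (s≤s⁻¹ t<n)))) y separates
allDistinguishing⇒distinguishing-pred {t = zero}                   G ()
allDistinguishing⇒distinguishing-pred {t = suc zero}               G (s≤s ())
allDistinguishing⇒distinguishing-pred {zero}           {suc (suc _)} G _ ()
allDistinguishing⇒distinguishing-pred {suc zero}       {suc (suc _)} G _ (s≤s ())
allDistinguishing⇒distinguishing-pred {suc (suc zero)} {suc (suc _)} G _ (s≤s (s≤s ()))

theorem3p7 : (n : ℕ) (G : Graph n) (t : ℕ) →
    IsDistinguishingThreshold G t → IsDistinguishingNumber G t →
    (t ≡ 1) ⊎ (t ≡ n)
theorem3p7 n G t (1≤t , allDist , _) (_ , least) with t ≟ℕ 1 | t ≟ℕ n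
... | yes t≡1 | _       = inj₁ t≡1
... | no _    | yes t≡n = inj₂ t≡n
... | no t≢1  | no t≢n  =
  contradiction (m≤pred[n]⇒suc[m]≤n ⦃ >-nonZero 1≤t ⦄ (least (pred t) fewerColours)) (n≮n t)
  where
  t≤n : t ≤ n
  t≤n = least n ((λ v → v) , λ _ _ πv≡v → πv≡v)
  fewerColours : Σ (Colouring n (pred t)) (Distinguishing G)
  fewerColours =
    allDistinguishing⇒distinguishing-pred G (≤∧≢⇒< 1≤t (t≢1 ∘ sym)) (≤∧≢⇒< t≤n t≢n) allDist
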